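{- Let $G$ be a simple undirected graph and let $\operatorname{OTI}(G)$ be the set of integers in $[m,M]$. Then $M-m\le\left\lfloor\frac{|E(G)|}{2}\right\rfloor$. Furthermore, $\operatorname{OTI}(G)$ is full, i.e. every integer $k$ with $m\le k\le M$ equals $\operatorname{th}(\vec G)$ for some orientation $\vec G$ of $G$.
   Context: An orientation $\vec G$ of $G$ replaces each edge $\{u,v\}$ by exactly one of $(u,v),(v,u)$. Zero forcing on a digraph: vertices are blue or white; a blue vertex $u$ with exactly one white out-neighbor $w$ may force $w$ ($u\to w$), turning it blue. A set $\mathcal F$ of forces is a set of forces of $B\subseteq V$ if, starting with exactly $B$ blue, the forces in $\mathcal F$ can be validly performed in some order after which no further force is possible. Put $\mathcal F^{[0]}=B$ and $\mathcal F^{[t+1]}=\mathcal F^{[t]}\cup\{w\notin\mathcal F^{[t]}:(u\to w)\in\mathcal F,\ u\in\mathcal F^{[t]},\ w$ the only out-neighbor of $u$ outside $\mathcal F^{[t]}\}$; $\operatorname{pt}(\Gamma;\mathcal F)$ is the least $t$ with $\mathcal F^{[t]}=V$ ($\infty$ if none); $\operatorname{pt}(\Gamma;B)=\min_{\mathcal F}\operatorname{pt}(\Gamma;\mathcal F)$; $\operatorname{th}(\Gamma)=\min_{B\subseteq V}(|B|+\operatorname{pt}(\Gamma;B))$. $\operatorname{OTI}(G)$ is the set of integers in $[m,M]$ where $m$, $M$ are the minimum and maximum of $\operatorname{th}(\vec G)$ over all orientations $\vec G$ of $G$. -}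

module Defs where

open import Data.Nat using (ℕ; zero; suc; _+_; _<_; _≤_; _<ᵇ_)
open import Data.Bool using (Bool; true; false; if_then_else_; _∧_)
open import Data.Fin using (Fin; toℕ)
open import Data.Fin.Subset using (Subset; _∈_; _∉_; inside; ∣_∣)
open import Data.Vec using (_[_]≔_)
open import Data.List using (List; []; _∷_; allFin; map)
open import Data.Nat.ListAction using (sum)
open import Data.List.Membership.Propositional using () renaming (_∈_ to _∈ₗ_)
open import Data.Product using (Σ; ∃; _×_; _,_)
open import Data.Sum using (_⊎_)
open import Relation.Binary.PropositionalEquality using (_≡_; _≢_)
open import Relation.Nullary using (¬_)
open import Function.Bundles using (_⇔_)

record SimpleGraph (n : ℕ) : Set where
  field
    adj    : Fin n → Fin n → Bool
    sym    : ∀ u v → adj u v ≡ adj v u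
    irrefl : ∀ u → adj u u ≡ false

open SimpleGraph public

numEdges : ∀ {n} → SimpleGraph n → ℕ
numEdges {n} G =
  sum (map (λ u → sum (map (λ v → if adj G u v ∧ (toℕ u <ᵇ toℕ v) then 1 else 0)
                           (allFin n)))
           (allFin n))

Digraph : ℕ → Set
Digraph n = Fin n → Fin n → Bool

record Orientation {n : ℕ} (G : SimpleGraph n) : Set where
  field
    dir     : Digraph n
    dir⊆adj : ∀ u v → dir u v ≡ true → adj G u v ≡ true
    covers  : ∀ u v → adj G u v ≡ true → dir u v ≡ true ⊎ dir v u ≡ true
    oneWay  : ∀ u v → dir u v ≡ true → dir v u ≡ false

open Orientation public

module _ {n : ℕ} (D : Digraph n) where

  CanForce : Subset n → Fin n → Fin n → Set
  CanForce S u w =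
    u ∈ S × w ∉ S × D u w ≡ true × (∀ v → D u v ≡ true → v ≢ w → v ∈ S)

  data Run : Subset n → List (Fin n × Fin n) → Subset n → Set where
    done : ∀ {S} → Run S [] S
    step : ∀ {S u w L S'} → CanForce S u w →
           Run (S [ w ]≔ inside) L S' → Run S ((u , w) ∷ L) S'

  Stalled : Subset n → Set
  Stalled S = ∀ u w → ¬ CanForce S u w

  Forces : Set
  Forces = Fin n → Fin n → Bool

  IsSetOfForces : Subset n → Forces → Set
  IsSetOfForces B F =
    Σ (List (Fin n × Fin n)) λ L → Σ (Subset n) λ S' →
      Run B L S' × Stalled S' × (∀ u w → ((u , w) ∈ₗ L) ⇔ (F u w ≡ true))

  Stage : Subset n → Forces → ℕ → Fin n → Set
  Stage B F zero    w = w ∈ B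
  Stage B F (suc t) w =
    Stage B F t w ⊎
    (¬ Stage B F t w ×
     ∃ λ u → F u w ≡ true × Stage B F t u × D u w ≡ true ×
             (∀ v → D u v ≡ true → ¬ Stage B F t v → v ≡ w))

  AllBlueAt : Subset n → Forces → ℕ → Set
  AllBlueAt B F t = ∀ w → Stage B F t w

  IsPT : Subset n → Forces → ℕ → Set
  IsPT B F t = AllBlueAt B F t × (∀ s → s < t → ¬ AllBlueAt B F s)

  -- th(Γ) = k : k is the minimum of |B| + pt(Γ;F) over B and sets of forces F of B
  -- (pairs with pt = ∞ contribute nothing to the minimum)
  IsTh : ℕ → Set
  IsTh k =
    (∃ λ B → ∃ λ F → ∃ λ t → IsSetOfForces B F × IsPT B F t × ∣ B ∣ + t ≡ k) ×
    (∀ B F t → IsSetOfForces B F → IsPT B F t → k ≤ ∣ B ∣ + t)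

IsMinOTh : ∀ {n} → SimpleGraph n → ℕ → Set
IsMinOTh G m =
  (∃ λ (o : Orientation G) → IsTh (dir o) m) ×
  (∀ (o : Orientation G) k → IsTh (dir o) k → m ≤ k)

IsMaxOTh : ∀ {n} → SimpleGraph n → ℕ → Set
IsMaxOTh G M =
  (∃ λ (o : Orientation G) → IsTh (dir o) M) ×
  (∀ (o : Orientation G) k → IsTh (dir o) k → k ≤ M)

module Submission where

-- 1. th as a function.  A pair (B, F) is well formed if no vertex of B is forced
--    and no vertex has two forcers; k is achievable if such a pair makes every
--    vertex blue by a stage t with |B| + t ≤ k.  Sets of forces are exactly the
--    well-formed pairs that are replayed as runs, so th D is the least achievable
--    k; achievability is decidable by exhaustive search, so th D exists.
-- 2. Reversing one arc raises th by at most one (add an endpoint of the arc to B),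
--    and reversing all arcs preserves th (run the forcing chains backwards).
-- 3. Walking from an orientation O₁ of minimum th to an orientation O₂ of maximum
--    th one edge at a time, th moves up by at most one per changed edge: every
--    value in [m, M] is attained, and M − m is at most the number of edges where
--    O₁ and O₂ differ.  The same holds for the reverse of O₂, which has th M too,
--    and every edge is a difference for exactly one of O₂ and its reverse.

open import Defs hiding (sym)
open import Data.Nat using (ℕ; zero; suc; _+_; _∸_; _≤_; _<_; z≤n; s≤s; _≤?_; _<?_; _<ᵇ_; ⌊_/2⌋)
open import Data.Nat.Properties
open import Data.Bool using (Bool; true; false; if_then_else_; not; _∧_; _xor_)
open import Data.Bool.Properties using (¬-not; T-≡) renaming (_≟_ to _≟B_)
open import Data.Fin using (Fin; toℕ; fromℕ<) renaming (zero to fz; suc to fs)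
open import Data.Fin.Properties using (any?; all?; toℕ<n; toℕ-fromℕ<; toℕ-injective)
  renaming (_≟_ to _≟F_; suc-injective to fs-injective; 0≢1+n to fz≢fs)
open import Data.Fin.Subset using (Subset; _∈_; _∉_; inside; outside; ∣_∣; ⊤)
open import Data.Fin.Subset.Properties using (_∈?_; anySubset?; ∈⊤; ∣⊤∣≡n)
open import Data.Vec using (Vec; []; _∷_; _[_]≔_; lookup; tabulate)
open import Data.Vec.Properties using ([]≔-updates; []≔-minimal; lookup∘update′; []=⇒lookup; lookup⇒[]=; lookup∘tabulate)
open import Data.List using (List; []; _∷_; allFin; _++_; cartesianProduct; map)
open import Data.Nat.ListAction using (sum)
open import Data.Nat.ListAction.Properties using (sum-++)
open import Data.List.Properties using (map-++; map-∘; map-cong)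
open import Data.List.Membership.Propositional using () renaming (_∈_ to _∈ₗ_)
open import Data.List.Membership.Propositional.Properties using (∈-allFin; ∈-++⁻; ∈-++⁺ˡ; ∈-++⁺ʳ; ∈-cartesianProduct⁺)
open import Data.List.Relation.Unary.Any using (here; there)
open import Data.Product using (Σ; ∃; ∃₂; _×_; _,_; proj₁; proj₂; map₂)
open import Data.Product.Properties using (≡-dec)
open import Data.Sum using (_⊎_; inj₁; inj₂; swap)
import Data.Sum
open import Data.Empty using (⊥; ⊥-elim)
open import Function using (const; _∘_)
open import Function.Bundles using (mk⇔; Equivalence)
open import Relation.Binary.PropositionalEquality
open import Relation.Nullary using (¬_; Dec; yes; no; does)
open import Relation.Binary.Definitions using (tri<; tri≈; tri>)
open import Relation.Nullary.Decidable using (_×-dec_; _⊎-dec_; _→-dec_; ¬?; map′; does-⇔; dec-true; dec-false)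
open import Algebra.Properties.CommutativeSemigroup +-commutativeSemigroup
  using () renaming (interchange to +-interchange)
open import Algebra.Properties.CommutativeMonoid.Sum +-0-commutativeMonoid
  using (sum-syntax; ∑-distrib-+; ∑-comm; sum-cong-≗) renaming (sum to ∑)

∈-insert : ∀ {n} (p : Subset n) (w : Fin n) → w ∈ p [ w ]≔ inside
∈-insert p w = []≔-updates p w

insert-⊇ : ∀ {n} (p : Subset n) (w x : Fin n) → x ∈ p → x ∈ p [ w ]≔ inside
insert-⊇ p w x x∈p with x ≟F w
... | yes refl = []≔-updates p w
... | no x≢w = []≔-minimal p x w x≢w x∈p

∈-insert⁻ : ∀ {n} (p : Subset n) (w x : Fin n) → x ∈ p [ w ]≔ inside → x ≡ w ⊎ x ∈ p
∈-insert⁻ p w x x∈p' with x ≟F w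
... | yes x≡w = inj₁ x≡w
... | no x≢w = inj₂ (lookup⇒[]= x p (trans (sym (lookup∘update′ x≢w p inside)) ([]=⇒lookup x∈p')))

∣insert∣ : ∀ {n} (p : Subset n) (w : Fin n) → ∣ p [ w ]≔ inside ∣ ≤ suc ∣ p ∣
∣insert∣ (inside  ∷ p) fz = n≤1+n _
∣insert∣ (outside ∷ p) fz = ≤-refl
∣insert∣ (inside  ∷ p) (fs w) = s≤s (∣insert∣ p w)
∣insert∣ (outside ∷ p) (fs w) = ∣insert∣ p w

module _ {P : ℕ → Set} (P? : ∀ k → Dec (P k)) where

  private
    leastUpTo : ∀ k → (∃ λ m → P m × (∀ j → P j → m ≤ j)) ⊎ (∀ j → j ≤ k → ¬ P j)
    leastUpTo zero with P? zero
    ... | yes p = inj₁ (zero , p , λ _ _ → z≤n)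
    ... | no ¬p = inj₂ λ { zero z≤n → ¬p }
    leastUpTo (suc k) with leastUpTo k | P? (suc k)
    ... | inj₁ found | _ = inj₁ found
    ... | inj₂ none | yes p = inj₁ (suc k , p , λ j pj → ≮⇒≥ (λ j<1+k → none j (≤-pred j<1+k) pj))
    ... | inj₂ none | no ¬p = inj₂ noneUpTo
      where
      noneUpTo : ∀ j → j ≤ suc k → ¬ P j
      noneUpTo j j≤1+k with m≤n⇒m<n∨m≡n j≤1+k
      ... | inj₁ j<1+k = none j (≤-pred j<1+k)
      ... | inj₂ refl = ¬p

  least : ∀ {k} → P k → ∃ λ m → P m × (∀ j → P j → m ≤ j)
  least {k} pk with leastUpTo k
  ... | inj₁ found = found
  ... | inj₂ none = ⊥-elim (none k ≤-refl pk)

∃≤? : (P : ℕ → Set) → (∀ t → Dec (P t)) → ∀ k → Dec (∃ λ t → t ≤ k × P t)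
∃≤? P P? k = map′ fromFin toFin (any? (λ i → P? (toℕ i)))
  where
  fromFin : ∃ (λ (i : Fin (suc k)) → P (toℕ i)) → ∃ λ t → t ≤ k × P t
  fromFin (i , p) = toℕ i , ≤-pred (toℕ<n i) , p
  toFin : (∃ λ t → t ≤ k × P t) → ∃ (λ (i : Fin (suc k)) → P (toℕ i))
  toFin (t , t≤k , p) = fromℕ< (s≤s t≤k) , subst P (sym (toℕ-fromℕ< (s≤s t≤k))) p

Searchable : Set → Set₁
Searchable A = ∀ (P : A → Set) → (∀ a → Dec (P a)) → Dec (∃ P)

searchVec : ∀ {A : Set} → Searchable A → ∀ m → Searchable (Vec A m)
searchVec searchA zero Q Q? = map′ (λ q → [] , q) (λ { ([] , q) → q }) (Q? [])
searchVec searchA (suc m) Q Q? =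
  map′ (λ { (a , v , q) → a ∷ v , q }) (λ { (a ∷ v , q) → a , v , q })
       (searchA (λ a → ∃ λ v → Q (a ∷ v)) (λ a → searchVec searchA m (λ v → Q (a ∷ v)) (λ v → Q? (a ∷ v))))

module _ {n : ℕ} (D : Digraph n) where

  stage-≤ : ∀ B F {s t} w → s ≤ t → Stage D B F s w → Stage D B F t w
  stage-≤ B F {t = zero} w z≤n blue = blue
  stage-≤ B F {t = suc t} w s≤1+t blue with m≤n⇒m<n∨m≡n s≤1+t
  ... | inj₁ s<1+t = inj₁ (stage-≤ B F w (≤-pred s<1+t) blue)
  ... | inj₂ refl = blue

  stage-B : ∀ B F t w → w ∈ B → Stage D B F t w
  stage-B B F t w w∈B = stage-≤ B F w z≤n w∈B

  stage? : ∀ B F t w → Dec (Stage D B F t w)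
  stage? B F zero w = w ∈? B
  stage? B F (suc t) w with stage? B F t w
  ... | yes blue = yes (inj₁ blue)
  ... | no white = map′ (λ (u , f , bu , d , only) → inj₂ (white , u , f , bu , d , only))
                        (λ { (inj₁ blue) → ⊥-elim (white blue) ; (inj₂ (_ , forced)) → forced })
                        (any? λ u → (F u w ≟B true) ×-dec (stage? B F t u ×-dec ((D u w ≟B true) ×-dec
                           all? (λ v → (D u v ≟B true) →-dec (¬? (stage? B F t v) →-dec (v ≟F w))))))

  allBlue? : ∀ B F t → Dec (AllBlueAt D B F t)
  allBlue? B F t = all? (stage? B F t)

  -- (B, F) is well formed if no vertex of B is forced and no vertex has two
  -- forcers; the forces performed by any run have this shape.
  WellFormed : Subset n → Forces D → Set
  WellFormed B F = (∀ x w → F x w ≡ true → w ∉ B) ×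
                   (∀ x x' w → F x w ≡ true → F x' w ≡ true → x ≡ x')

  -- k is achievable if a well-formed (B, F) makes every vertex blue by some
  -- stage t with |B| + t ≤ k.  The throttling number is the least achievable k.
  Achievable : ℕ → Set
  Achievable k = Σ (Subset n) λ B → Σ (Forces D) λ F → Σ ℕ λ t →
                 WellFormed B F × AllBlueAt D B F t × ∣ B ∣ + t ≤ k

  forcer-blue : ∀ B F → WellFormed B F → ∀ s x w → F x w ≡ true → w ∉ B →
                Stage D B F s w → Stage D B F s x
  forcer-blue B F wf zero x w f w∉B blue = ⊥-elim (w∉B blue)
  forcer-blue B F wf (suc s) x w f w∉B (inj₁ blue) = inj₁ (forcer-blue B F wf s x w f w∉B blue)
  forcer-blue B F wf (suc s) x w f w∉B (inj₂ (_ , u , fu , bu , _)) with proj₂ wf u x w fu f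
  ... | refl = inj₁ bu

  blue⇒forced : ∀ B F s w → Stage D B F s w → w ∈ B ⊎ ∃ λ x → F x w ≡ true
  blue⇒forced B F zero w w∈B = inj₁ w∈B
  blue⇒forced B F (suc s) w (inj₁ blue) = blue⇒forced B F s w blue
  blue⇒forced B F (suc s) w (inj₂ (_ , x , f , _)) = inj₂ (x , f)

  run-⊇ : ∀ {S L S'} → Run D S L S' → ∀ v → v ∈ S → v ∈ S'
  run-⊇ done v v∈S = v∈S
  run-⊇ (step {w = w} _ r) v v∈S = run-⊇ r v (insert-⊇ _ w v v∈S)

  run-target∉ : ∀ {S L S'} → Run D S L S' → ∀ x v → v ∈ S → ¬ (x , v) ∈ₗ L
  run-target∉ (step (_ , w∉S , _) r) x v v∈S (here refl) = w∉S v∈S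
  run-target∉ (step {w = w} _ r) x v v∈S (there m) = run-target∉ r x v (insert-⊇ _ w v v∈S) m

  run-forcer-unique : ∀ {S L S'} → Run D S L S' → ∀ x x' v → (x , v) ∈ₗ L → (x' , v) ∈ₗ L → x ≡ x'
  run-forcer-unique (step _ r) x x' v (here refl) (here refl) = refl
  run-forcer-unique {S} (step _ r) x x' v (here refl) (there m') = ⊥-elim (run-target∉ r x' v (∈-insert S v) m')
  run-forcer-unique {S} (step _ r) x x' v (there m) (here refl) = ⊥-elim (run-target∉ r x v (∈-insert S v) m)
  run-forcer-unique (step _ r) x x' v (there m) (there m') = run-forcer-unique r x x' v m m'

  run-++ : ∀ {S L S' L' S''} → Run D S L S' → Run D S' L' S'' → Run D S (L ++ L') S''
  run-++ done r' = r'
  run-++ (step c r) r' = step c (run-++ r r')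

  setOfForces⇒wellFormed : ∀ B F → IsSetOfForces D B F → WellFormed B F
  setOfForces⇒wellFormed B F (L , S' , r , _ , L⇔F) =
    (λ x w f w∈B → run-target∉ r x w w∈B (inF x w f)) ,
    (λ x x' w f f' → run-forcer-unique r x x' w (inF x w f) (inF x' w f'))
    where
    inF : ∀ x w → F x w ≡ true → (x , w) ∈ₗ L
    inF x w = Equivalence.from (L⇔F x w)

  -- Conversely, the staged process of a well-formed (B, F) that makes everything
  -- blue can be replayed as a run using exactly the forces of F.
  module Replay (B : Subset n) (F : Forces D) where

    FRun : Subset n → List (Fin n × Fin n) → Subset n → Set
    FRun S L S' = Run D S L S' × (∀ x w → (x , w) ∈ₗ L → F x w ≡ true) ×
                  (∀ v → v ∈ S' → v ∈ S ⊎ ∃ λ x → (x , v) ∈ₗ L)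

    frun-done : ∀ {S} → FRun S [] S
    frun-done = done , (λ _ _ ()) , (λ v v∈S → inj₁ v∈S)

    frun-force : ∀ {S x w} → CanForce D S x w → F x w ≡ true → FRun S ((x , w) ∷ []) (S [ w ]≔ inside)
    frun-force {S} {x} {w} c f = step c done , inF , new
      where
      inF : ∀ x' w' → (x' , w') ∈ₗ (x , w) ∷ [] → F x' w' ≡ true
      inF _ _ (here refl) = f
      new : ∀ v → v ∈ S [ w ]≔ inside → v ∈ S ⊎ ∃ λ x' → (x' , v) ∈ₗ (x , w) ∷ []
      new v v∈S' with ∈-insert⁻ S w v v∈S'
      ... | inj₁ refl = inj₂ (x , here refl)
      ... | inj₂ v∈S = inj₁ v∈S

    frun-++ : ∀ {S L S' L' S''} → FRun S L S' → FRun S' L' S'' → FRun S (L ++ L') S''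
    frun-++ {S} {L} {S'} {L'} {S''} (r , inF , new) (r' , inF' , new') = run-++ r r' , inF'' , new''
      where
      inF'' : ∀ x w → (x , w) ∈ₗ L ++ L' → F x w ≡ true
      inF'' x w m with ∈-++⁻ L m
      ... | inj₁ m₁ = inF x w m₁
      ... | inj₂ m₂ = inF' x w m₂
      new'' : ∀ v → v ∈ S'' → v ∈ S ⊎ ∃ λ x → (x , v) ∈ₗ L ++ L'
      new'' v v∈S'' with new' v v∈S''
      ... | inj₂ (x , m) = inj₂ (x , ∈-++⁺ʳ L m)
      ... | inj₁ v∈S' with new v v∈S'
      ...   | inj₁ v∈S = inj₁ v∈S
      ...   | inj₂ (x , m) = inj₂ (x , ∈-++⁺ˡ m)

    Covers : ℕ → Subset n → Set
    Covers s S = ∀ v → Stage D B F s v → v ∈ S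

    coverVertex : ∀ s w S → Covers s S → ∃₂ λ L S' → FRun S L S' × (Stage D B F (suc s) w → w ∈ S')
    coverVertex s w S cov with w ∈? S | stage? B F (suc s) w
    ... | yes w∈S | _ = [] , S , frun-done , const w∈S
    ... | no _ | no white = [] , S , frun-done , λ blue → ⊥-elim (white blue)
    ... | no w∉S | yes (inj₁ blue) = ⊥-elim (w∉S (cov w blue))
    ... | no w∉S | yes (inj₂ (_ , x , f , bx , d , only)) =
          _ , _ , frun-force (cov x bx , w∉S , d , othersBlue) f , const (∈-insert S w)
      where
      othersBlue : ∀ v → D x v ≡ true → v ≢ w → v ∈ S
      othersBlue v dv v≢w with stage? B F s v
      ... | yes bv = cov v bv
      ... | no wv = ⊥-elim (v≢w (only v dv wv))

    coverVertices : ∀ s ws S → Covers s S →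
                    ∃₂ λ L S' → FRun S L S' × (∀ v → v ∈ₗ ws → Stage D B F (suc s) v → v ∈ S')
    coverVertices s [] S cov = [] , S , frun-done , λ _ ()
    coverVertices s (w ∷ ws) S cov with coverVertex s w S cov
    ... | L₁ , S₁ , r₁ , c₁ with coverVertices s ws S₁ (λ v bv → run-⊇ (proj₁ r₁) v (cov v bv))
    ...   | L₂ , S₂ , r₂ , c₂ = L₁ ++ L₂ , S₂ , frun-++ r₁ r₂ , covered
      where
      covered : ∀ v → v ∈ₗ w ∷ ws → Stage D B F (suc s) v → v ∈ S₂
      covered v (here refl) bv = run-⊇ (proj₁ r₂) v (c₁ bv)
      covered v (there m) bv = c₂ v m bv

    coverStage : ∀ s → ∃₂ λ L S' → FRun B L S' × Covers s S'
    coverStage zero = [] , B , frun-done , λ v blue → blue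
    coverStage (suc s) with coverStage s
    ... | L₁ , S₁ , r₁ , c₁ with coverVertices s (allFin n) S₁ c₁
    ...   | L₂ , S₂ , r₂ , c₂ = L₁ ++ L₂ , S₂ , frun-++ r₁ r₂ , λ v bv → c₂ v (∈-allFin v) bv

    -- the run covering the final stage stalls, and it uses every force of F
    -- since every vertex outside B has its unique forcer in the run
    setOfForces : WellFormed B F → ∀ t → AllBlueAt D B F t → IsSetOfForces D B F
    setOfForces wf t allBlue with coverStage t
    ... | L , S' , (r , inF , new) , cov = L , S' , r , stalled , λ u w → mk⇔ (inF u w) (inL u w)
      where
      stalled : Stalled D S'
      stalled u w (_ , w∉S' , _) = w∉S' (cov w (allBlue w))
      inL : ∀ u w → F u w ≡ true → (u , w) ∈ₗ L
      inL u w f with new w (cov w (allBlue w))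
      ... | inj₁ w∈B = ⊥-elim (proj₁ wf u w f w∈B)
      ... | inj₂ (x , m) with proj₂ wf x u w (inF x w m) f
      ...   | refl = m

_≐_ : ∀ {n} (R R' : Fin n → Fin n → Bool) → Set
R ≐ R' = ∀ x y → R x y ≡ R' x y

stage-mono : ∀ {n} (D D' : Digraph n) (B B' : Subset n) (F F' : Forces D) →
  (∀ w → w ∈ B → w ∈ B') →
  (∀ x w → F x w ≡ true → D x w ≡ true → w ∈ B' ⊎ (F' x w ≡ true × D' x w ≡ true)) →
  (∀ s x w y → F x w ≡ true → Stage D B F s x → D' x y ≡ true → y ≢ w →
     D x y ≡ true ⊎ (y ∈ B' ⊎ Stage D B F s y)) →
  ∀ s w → Stage D B F s w → Stage D' B' F' s w
stage-mono D D' B B' F F' B⊆B' forces neighbours = go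
  where
  go : ∀ s w → Stage D B F s w → Stage D' B' F' s w
  go zero w w∈B = B⊆B' w w∈B
  go (suc s) w (inj₁ blue) = inj₁ (go s w blue)
  go (suc s) w (inj₂ (_ , x , f , bx , d , only)) with forces x w f d | stage? D' B' F' s w
  ... | inj₁ w∈B' | _ = stage-B D' B' F' (suc s) w w∈B'
  ... | inj₂ _ | yes blue' = inj₁ blue'
  ... | inj₂ (f' , d') | no white' = inj₂ (white' , x , f' , go s x bx , d' , only')
    where
    only' : ∀ y → D' x y ≡ true → ¬ Stage D' B' F' s y → y ≡ w
    only' y d'y white'y with y ≟F w
    ... | yes y≡w = y≡w
    ... | no y≢w with neighbours s x w y f bx d'y y≢w
    ...   | inj₁ dy = only y dy (λ by → white'y (go s y by))
    ...   | inj₂ (inj₁ y∈B') = ⊥-elim (white'y (stage-B D' B' F' s y y∈B'))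
    ...   | inj₂ (inj₂ by) = ⊥-elim (white'y (go s y by))

module _ {n : ℕ} {D D' : Digraph n} (D≐D' : D ≐ D') where

  achievable-cong : ∀ {B F F' t} → F ≐ F' → WellFormed D B F → AllBlueAt D B F t →
                    WellFormed D' B F' × AllBlueAt D' B F' t
  achievable-cong {B} {F} {F'} {t} F≐F' (notInB , uniqueForcer) allBlue =
    ((λ x w f' → notInB x w (trans (F≐F' x w) f')) ,
     (λ x x' w f' f'' → uniqueForcer x x' w (trans (F≐F' x w) f') (trans (F≐F' x' w) f''))) ,
    (λ w → stage-mono D D' B B F F' (λ _ w∈B → w∈B)
             (λ x w f d → inj₂ (trans (sym (F≐F' x w)) f , trans (sym (D≐D' x w)) d))
             (λ s x w y _ _ d' _ → inj₁ (trans (D≐D' x y) d')) t w (allBlue w))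

  achievable-transport : ∀ {k} → Achievable D k → Achievable D' k
  achievable-transport (B , F , t , wf , allBlue , le) with achievable-cong (λ _ _ → refl) wf allBlue
  ... | wf' , allBlue' = B , F , t , wf' , allBlue' , le

module _ {n : ℕ} (D : Digraph n) where

  Achievable? : ∀ k → Dec (Achievable D k)
  Achievable? k =
    map′ fromTable toTable
      (anySubset? λ B → searchVec (λ P P? → anySubset? P?) n _ λ V →
        ∃≤? _ (λ t → wellFormed? B (table V) ×-dec (allBlue? D B (table V) t ×-dec (∣ B ∣ + t ≤? k))) k)
    where
    table : Vec (Subset n) n → Forces D
    table V x w = lookup (lookup V x) w

    wellFormed? : ∀ B F → Dec (WellFormed D B F)
    wellFormed? B F =
      all? (λ x → all? λ w → (F x w ≟B true) →-dec ¬? (w ∈? B)) ×-dec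
      all? (λ x → all? λ x' → all? λ w → (F x w ≟B true) →-dec ((F x' w ≟B true) →-dec (x ≟F x')))

    AchievableByTable : Set
    AchievableByTable = ∃ λ B → ∃ λ V → ∃ λ t → t ≤ k ×
      (WellFormed D B (table V) × AllBlueAt D B (table V) t × ∣ B ∣ + t ≤ k)

    fromTable : AchievableByTable → Achievable D k
    fromTable (B , V , t , _ , wf , allBlue , le) = B , table V , t , wf , allBlue , le

    toTable : Achievable D k → AchievableByTable
    toTable (B , F , t , wf , allBlue , le) with achievable-cong {D = D} (λ _ _ → refl) F≐ wf allBlue
      where
      F≐ : F ≐ table (tabulate λ x → tabulate (F x))
      F≐ x w = sym (trans (cong (λ row → lookup row w) (lookup∘tabulate _ x)) (lookup∘tabulate (F x) w))
    ... | wf' , allBlue' = B , tabulate (λ x → tabulate (F x)) , t , ≤-trans (m≤n+m t ∣ B ∣) le , wf' , allBlue' , le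

module _ {n : ℕ} (D : Digraph n) where

  leastPT : ∀ B F t → AllBlueAt D B F t → ∃ λ t' → t' ≤ t × IsPT D B F t'
  leastPT B F t allBlue with least (allBlue? D B F) allBlue
  ... | t' , allBlue' , minimal = t' , minimal t allBlue , allBlue' , λ s s<t' allBlueₛ → <⇒≱ s<t' (minimal s allBlueₛ)

  isTh⇒achievable : ∀ k → IsTh D k → Achievable D k
  isTh⇒achievable k ((B , F , t , sof , pt , eq) , _) =
    B , F , t , setOfForces⇒wellFormed D B F sof , proj₁ pt , ≤-reflexive eq

  isTh⇒≤achievable : ∀ k → IsTh D k → ∀ j → Achievable D j → k ≤ j
  isTh⇒≤achievable k (_ , minimal) j (B , F , t , wf , allBlue , le) with leastPT B F t allBlue
  ... | t' , t'≤t , pt = ≤-trans (minimal B F t' (Replay.setOfForces D B F wf t' (proj₁ pt)) pt)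
                                 (≤-trans (+-monoʳ-≤ ∣ B ∣ t'≤t) le)

  leastAchievable⇒isTh : ∀ k → Achievable D k → (∀ j → Achievable D j → k ≤ j) → IsTh D k
  leastAchievable⇒isTh k (B , F , t , wf , allBlue , le) minimal with leastPT B F t allBlue
  ... | t' , t'≤t , pt = (B , F , t' , Replay.setOfForces D B F wf t' (proj₁ pt) , pt , eq) ,
                         (λ B' F' t'' sof pt' → minimal _ (B' , F' , t'' , setOfForces⇒wellFormed D B' F' sof , proj₁ pt' , ≤-refl))
    where
    eq : ∣ B ∣ + t' ≡ k
    eq = ≤-antisym (≤-trans (+-monoʳ-≤ ∣ B ∣ t'≤t) le) (minimal _ (B , F , t' , wf , proj₁ pt , ≤-refl))

  allBlue-achievable : Achievable D n
  allBlue-achievable = ⊤ , (λ _ _ → false) , 0 , ((λ _ _ ()) , (λ _ _ _ ())) , (λ _ → ∈⊤) ,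
                       ≤-reflexive (trans (+-identityʳ _) (∣⊤∣≡n n))

  thExists : ∃ (IsTh D)
  thExists with least (Achievable? D) allBlue-achievable
  ... | k , achievable , minimal = k , leastAchievable⇒isTh k achievable minimal

abstract
  th : ∀ {n} → Digraph n → ℕ
  th D = proj₁ (thExists D)

  th-spec : ∀ {n} (D : Digraph n) → IsTh D (th D)
  th-spec D = proj₂ (thExists D)

th-unique : ∀ {n} (D : Digraph n) k → IsTh D k → th D ≡ k
th-unique D k isTh = ≤-antisym (isTh⇒≤achievable D (th D) (th-spec D) k (isTh⇒achievable D k isTh))
                               (isTh⇒≤achievable D k isTh (th D) (isTh⇒achievable D (th D) (th-spec D)))

th-≤ : ∀ {n} (D D' : Digraph n) → (∀ k → Achievable D k → Achievable D' k) → th D' ≤ th D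
th-≤ D D' transfer = isTh⇒≤achievable D' (th D') (th-spec D') (th D)
                       (transfer _ (isTh⇒achievable D (th D) (th-spec D)))

th-cong : ∀ {n} (D D' : Digraph n) → D ≐ D' → th D ≡ th D'
th-cong D D' D≐D' = ≤-antisym (th-≤ D' D (λ _ → achievable-transport (λ x y → sym (D≐D' x y))))
                              (th-≤ D D' (λ _ → achievable-transport D≐D'))

module AddToB {n : ℕ} (D D' : Digraph n) {B : Subset n} {F : Forces D} {t : ℕ}
              (wf : WellFormed D B F) (allBlue : AllBlueAt D B F t) (z : Fin n) where

  B' : Subset n
  B' = B [ z ]≔ inside

  F' : Forces D'
  F' x w = if does (w ≟F z) then false else F x w

  F'⇒F : ∀ x w → F' x w ≡ true → F x w ≡ true × w ≢ z
  F'⇒F x w = dropped (w ≟F z)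
    where
    dropped : (d : Dec (w ≡ z)) → (if does d then false else F x w) ≡ true → F x w ≡ true × w ≢ z
    dropped (no w≢z) f = f , w≢z

  F⇒F' : ∀ x w → F x w ≡ true → w ≢ z → F' x w ≡ true
  F⇒F' x w f w≢z = kept (w ≟F z)
    where
    kept : (d : Dec (w ≡ z)) → (if does d then false else F x w) ≡ true
    kept (yes w≡z) = ⊥-elim (w≢z w≡z)
    kept (no _) = f

  wellFormed' : WellFormed D' B' F'
  wellFormed' = notInB' , λ x x' w f f' → proj₂ wf x x' w (proj₁ (F'⇒F x w f)) (proj₁ (F'⇒F x' w f'))
    where
    notInB' : ∀ x w → F' x w ≡ true → w ∉ B'
    notInB' x w f' w∈B' with F'⇒F x w f' | ∈-insert⁻ B z w w∈B'
    ... | _ , w≢z | inj₁ w≡z = w≢z w≡z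
    ... | f , _ | inj₂ w∈B = proj₁ wf x w f w∈B

  achievable : ∀ {k} → ∣ B ∣ + t ≤ k →
    (∀ x w → F x w ≡ true → D x w ≡ true → w ≢ z → D' x w ≡ true) →
    (∀ s x w y → F x w ≡ true → Stage D B F s x → D' x y ≡ true → y ≢ w →
       D x y ≡ true ⊎ (y ≡ z ⊎ Stage D B F s y)) →
    Achievable D' (suc k)
  achievable {k} le keptArcs newArcs =
    B' , F' , t , wellFormed' , (λ w → stage-mono D D' B B' F F' (λ v → insert-⊇ B z v) forces neighbours t w (allBlue w)) ,
    ≤-trans (+-monoˡ-≤ t (∣insert∣ B z)) (s≤s le)
    where
    forces : ∀ x w → F x w ≡ true → D x w ≡ true → w ∈ B' ⊎ (F' x w ≡ true × D' x w ≡ true)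
    forces x w f d = byCase (w ≟F z)
      where
      byCase : Dec (w ≡ z) → w ∈ B' ⊎ (F' x w ≡ true × D' x w ≡ true)
      byCase (yes refl) = inj₁ (∈-insert B z)
      byCase (no w≢z) = inj₂ (F⇒F' x w f w≢z , keptArcs x w f d w≢z)
    neighbours : ∀ s x w y → F x w ≡ true → Stage D B F s x → D' x y ≡ true → y ≢ w →
                 D x y ≡ true ⊎ (y ∈ B' ⊎ Stage D B F s y)
    neighbours s x w y f bx d' y≢w with newArcs s x w y f bx d' y≢w
    ... | inj₁ d = inj₁ d
    ... | inj₂ (inj₁ refl) = inj₂ (inj₁ (∈-insert B z))
    ... | inj₂ (inj₂ by) = inj₂ (inj₂ by)

ReversesArc : ∀ {n} (D D' : Digraph n) (a b : Fin n) → Set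
ReversesArc D D' a b = (∀ x y → D' x y ≡ true → D x y ≡ true ⊎ (x ≡ b × y ≡ a)) ×
                       (∀ x y → D x y ≡ true → D' x y ≡ true ⊎ (x ≡ a × y ≡ b))

-- Reversing one arc a → b costs at most one extra blue vertex: add b to B if
-- a → b is a force (a is then blue whenever b is), and add a otherwise.
reverseArc-achievable : ∀ {n} (D D' : Digraph n) (a b : Fin n) → ReversesArc D D' a b →
                        ∀ k → Achievable D k → Achievable D' (suc k)
reverseArc-achievable D D' a b (newArc , lostArc) k (B , F , t , wf , allBlue , le) with F a b in ab
... | true = AddToB.achievable D D' wf allBlue b le keptArcs newArcs
  where
  keptArcs : ∀ x w → F x w ≡ true → D x w ≡ true → w ≢ b → D' x w ≡ true
  keptArcs x w f d w≢b with lostArc x w d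
  ... | inj₁ d' = d'
  ... | inj₂ (_ , w≡b) = ⊥-elim (w≢b w≡b)
  newArcs : ∀ s x w y → F x w ≡ true → Stage D B F s x → D' x y ≡ true → y ≢ w →
            D x y ≡ true ⊎ (y ≡ b ⊎ Stage D B F s y)
  newArcs s x w y f bx d' _ with newArc x y d'
  ... | inj₁ d = inj₁ d
  ... | inj₂ (refl , refl) = inj₂ (inj₂ (forcer-blue D B F wf s a b ab (proj₁ wf a b ab) bx))
... | false = AddToB.achievable D D' wf allBlue a le keptArcs newArcs
  where
  keptArcs : ∀ x w → F x w ≡ true → D x w ≡ true → w ≢ a → D' x w ≡ true
  keptArcs x w f d _ with lostArc x w d
  ... | inj₁ d' = d'
  ... | inj₂ (refl , refl) with trans (sym f) ab
  ...   | ()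
  newArcs : ∀ s x w y → F x w ≡ true → Stage D B F s x → D' x y ≡ true → y ≢ w →
            D x y ≡ true ⊎ (y ≡ a ⊎ Stage D B F s y)
  newArcs s x w y _ _ d' _ with newArc x y d'
  ... | inj₁ d = inj₁ d
  ... | inj₂ (_ , y≡a) = inj₂ (inj₁ y≡a)

th-reverseArc : ∀ {n} (D D' : Digraph n) (a b : Fin n) → ReversesArc D D' a b → th D' ≤ suc (th D)
th-reverseArc D D' a b rev =
  isTh⇒≤achievable D' (th D') (th-spec D') _ (reverseArc-achievable D D' a b rev _ (isTh⇒achievable D (th D) (th-spec D)))

⟦_⟧ : Bool → ℕ
⟦ b ⟧ = if b then 1 else 0

∑-ones : ∀ n → ∑[ i < n ] 1 ≡ n
∑-ones zero = refl
∑-ones (suc n) = cong suc (∑-ones n)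

∣p∣≡∑ : ∀ {n} (p : Subset n) → ∣ p ∣ ≡ ∑[ i < n ] ⟦ lookup p i ⟧
∣p∣≡∑ [] = refl
∣p∣≡∑ (inside ∷ p) = cong suc (∣p∣≡∑ p)
∣p∣≡∑ (outside ∷ p) = ∣p∣≡∑ p

∑-none : ∀ {n} (b : Fin n → Bool) → (∀ i → b i ≡ false) → ∑[ i < n ] ⟦ b i ⟧ ≡ 0
∑-none {zero} b none = refl
∑-none {suc n} b none rewrite none fz = ∑-none (λ i → b (fs i)) (λ i → none (fs i))

∑-unique : ∀ {n} (b : Fin n → Bool) → (∀ i j → b i ≡ true → b j ≡ true → i ≡ j) →
           ∀ i → b i ≡ true → ∑[ i < n ] ⟦ b i ⟧ ≡ 1
∑-unique {suc n} b unique fz b0 rewrite b0 =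
  cong suc (∑-none (b ∘ fs) λ j → ¬-not λ bj → fz≢fs (unique fz (fs j) b0 bj))
∑-unique {suc n} b unique (fs i) bi rewrite ¬-not {b fz} (λ b0 → fz≢fs (unique fz (fs i) b0 bi)) =
  ∑-unique (b ∘ fs) (λ j j' p q → fs-injective (unique (fs j) (fs j') p q)) i bi

exactlyOne : ∀ {n} (c : Bool) (b : Fin n → Bool) → (∀ i j → b i ≡ true → b j ≡ true → i ≡ j) →
             (c ≡ true → ∀ i → b i ≡ false) → (c ≡ false → ∃ λ i → b i ≡ true) →
             ⟦ c ⟧ + ∑[ i < n ] ⟦ b i ⟧ ≡ 1
exactlyOne true b unique none _ = cong suc (∑-none b (none refl))
exactlyOne false b unique _ some with some refl
... | i , bi = ∑-unique b unique i bi

-- Reversing every arc preserves the throttling number: the forcing chains of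
-- (B, F) are run backwards from their ends.  If x forces w at step τ w, then in
-- the reverse w forces x at step t + 1 − τ w; the new initial set is the set of
-- chain ends (vertices forcing nothing), which has the same size as B because
-- every vertex starts exactly one chain link and ends exactly one.

_ᵀ : ∀ {n} → Digraph n → Digraph n
(D ᵀ) u v = D v u

module Reverse {n : ℕ} (D : Digraph n) {B : Subset n} {F : Forces D} {t : ℕ}
               (wf : WellFormed D B F) (allBlue : AllBlueAt D B F t) where

  first : ∀ w → ∃ λ m → Stage D B F m w × (∀ j → Stage D B F j w → m ≤ j)
  first w = least (λ s → stage? D B F s w) (allBlue w)

  τ : Fin n → ℕ
  τ w = proj₁ (first w)

  τ-minimal : ∀ w s → Stage D B F s w → τ w ≤ s
  τ-minimal w = proj₂ (proj₂ (first w))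

  τ≤t : ∀ w → τ w ≤ t
  τ≤t w = τ-minimal w t (allBlue w)

  ForcedAt : Fin n → Fin n → ℕ → Set
  ForcedAt y z s = Stage D B F s y × D y z ≡ true × (∀ v → D y v ≡ true → ¬ Stage D B F s v → v ≡ z)

  forcedAt : ∀ y z → F y z ≡ true → ∃ λ s → τ z ≡ suc s × ForcedAt y z s
  forcedAt y z f = entered (τ z) (proj₁ (proj₂ (first z))) (τ-minimal z)
    where
    entered : ∀ m → Stage D B F m z → (∀ j → Stage D B F j z → m ≤ j) → ∃ λ s → m ≡ suc s × ForcedAt y z s
    entered zero z∈B _ = ⊥-elim (proj₁ wf y z f z∈B)
    entered (suc s) (inj₁ blue) minimal = ⊥-elim (1+n≰n (minimal s blue))
    entered (suc s) (inj₂ (_ , u , fu , bu , d , only)) _ with proj₂ wf u y z fu f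
    ... | refl = s , refl , bu , d , only

  force-is-arc : ∀ y z → F y z ≡ true → D y z ≡ true
  force-is-arc y z f with forcedAt y z f
  ... | _ , _ , _ , d , _ = d

  forcer-earlier : ∀ y z → F y z ≡ true → τ y < τ z
  forcer-earlier y z f with forcedAt y z f
  ... | s , τz≡1+s , by , _ = subst (τ y <_) (sym τz≡1+s) (s≤s (τ-minimal y s by))

  neighbour-earlier : ∀ y z w → F y z ≡ true → D y w ≡ true → w ≢ z → τ w < τ z
  neighbour-earlier y z w f d w≢z with forcedAt y z f
  ... | s , τz≡1+s , _ , _ , only = subst (τ w <_) (sym τz≡1+s) (s≤s (τ-minimal w s bw))
    where
    bw : Stage D B F s w
    bw with stage? D B F s w
    ... | yes blue = blue
    ... | no white = ⊥-elim (w≢z (only w d white))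

  target-unique : ∀ y z z' → F y z ≡ true → F y z' ≡ true → z ≡ z'
  target-unique y z z' f f' with z ≟F z'
  ... | yes z≡z' = z≡z'
  ... | no z≢z' = ⊥-elim (<-asym (neighbour-earlier y z z' f (force-is-arc y z' f') (z≢z' ∘ sym))
                                 (neighbour-earlier y z' z f' (force-is-arc y z f) z≢z'))

  Fᵀ : Forces (D ᵀ)
  Fᵀ u v = F v u

  forces? : ∀ x → Dec (∃ λ w → F x w ≡ true)
  forces? x = any? (λ w → F x w ≟B true)

  Bᵀ : Subset n
  Bᵀ = tabulate (λ x → not (does (forces? x)))

  ∈Bᵀ : ∀ x → (∀ w → F x w ≡ true → ⊥) → x ∈ Bᵀ
  ∈Bᵀ x none = lookup⇒[]= x Bᵀ (trans (lookup∘tabulate _ x) (endsChain (forces? x)))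
    where
    endsChain : (d : Dec (∃ λ w → F x w ≡ true)) → not (does d) ≡ true
    endsChain (yes (w , f)) = ⊥-elim (none w f)
    endsChain (no _) = refl

  ∉Bᵀ : ∀ x w → F x w ≡ true → x ∉ Bᵀ
  ∉Bᵀ x w f x∈Bᵀ = forcesNothing (forces? x) (trans (sym (lookup∘tabulate _ x)) ([]=⇒lookup x∈Bᵀ))
    where
    forcesNothing : (d : Dec (∃ λ w → F x w ≡ true)) → not (does d) ≡ true → ⊥
    forcesNothing (no none) _ = none (w , f)

  wellFormedᵀ : WellFormed (D ᵀ) Bᵀ Fᵀ
  wellFormedᵀ = (λ x w f → ∉Bᵀ w x f) , (λ x x' w f f' → target-unique w x x' f f')

  Ready : ℕ → Fin n → Set
  Ready s x = x ∈ Bᵀ ⊎ ∃ λ w → F x w ≡ true × t < τ w + s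

  ready : ∀ s x → (∀ w → F x w ≡ true → t < τ w + s) → Ready s x
  ready s x late with forces? x
  ... | yes (w , f) = inj₂ (w , f , late w f)
  ... | no none = inj₁ (∈Bᵀ x (λ w f → none (w , f)))

  ready⇒blue : ∀ s x → Ready s x → Stage (D ᵀ) Bᵀ Fᵀ s x
  ready⇒blue zero x (inj₁ x∈Bᵀ) = x∈Bᵀ
  ready⇒blue zero x (inj₂ (w , _ , t<τw+0)) = ⊥-elim (<⇒≱ t<τw+0 (≤-trans (≤-reflexive (+-identityʳ (τ w))) (τ≤t w)))
  ready⇒blue (suc s) x (inj₁ x∈Bᵀ) = stage-B (D ᵀ) Bᵀ Fᵀ (suc s) x x∈Bᵀ
  ready⇒blue (suc s) x (inj₂ (w , f , late)) with t <? τ w + s | stage? (D ᵀ) Bᵀ Fᵀ s x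
  ... | yes earlier | _ = inj₁ (ready⇒blue s x (inj₂ (w , f , earlier)))
  ... | no _ | yes blue = inj₁ blue
  ... | no notEarlier | no white =
        inj₂ (white , w , f , ready⇒blue s w (ready s w wLate) , force-is-arc x w f , only)
    where
    τw+s≡t : τ w + s ≡ t
    τw+s≡t = ≤-antisym (≮⇒≥ notEarlier) (≤-pred (subst (t <_) (+-suc (τ w) s) late))
    after-w : ∀ z → τ w < τ z → t < τ z + s
    after-w z τw<τz = subst (_< τ z + s) τw+s≡t (+-monoˡ-< s τw<τz)
    wLate : ∀ z → F w z ≡ true → t < τ z + s
    wLate z f' = after-w z (forcer-earlier w z f')
    only : ∀ v → (D ᵀ) w v ≡ true → ¬ Stage (D ᵀ) Bᵀ Fᵀ s v → v ≡ x
    only v d whiteᵥ with v ≟F x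
    ... | yes v≡x = v≡x
    ... | no v≢x = ⊥-elim (whiteᵥ (ready⇒blue s v (ready s v vLate)))
      where
      vLate : ∀ z → F v z ≡ true → t < τ z + s
      vLate z f' with z ≟F w
      ... | yes refl = ⊥-elim (v≢x (proj₂ wf v x z f' f))
      ... | no z≢w = after-w z (neighbour-earlier v z w f' d (z≢w ∘ sym))

  allBlueᵀ : AllBlueAt (D ᵀ) Bᵀ Fᵀ t
  allBlueᵀ x = ready⇒blue t x (ready t x λ w f → +-monoˡ-< t (≤-trans (s≤s z≤n) (forcer-earlier x w f)))

  -- Every vertex either ends a chain or forces exactly one vertex, and either
  -- lies in B or is forced by exactly one vertex; summing both over all
  -- vertices and cancelling the number of forces gives |Bᵀ| = |B|.
  endsOrForces : ∀ x → ⟦ lookup Bᵀ x ⟧ + ∑[ w < n ] ⟦ F x w ⟧ ≡ 1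
  endsOrForces x = exactlyOne (lookup Bᵀ x) (F x) (target-unique x) noForce someForce
    where
    noForce : lookup Bᵀ x ≡ true → ∀ w → F x w ≡ false
    noForce x∈Bᵀ w = ¬-not (λ f → ∉Bᵀ x w f (lookup⇒[]= x Bᵀ x∈Bᵀ))
    someForce : lookup Bᵀ x ≡ false → ∃ λ w → F x w ≡ true
    someForce x∉Bᵀ with forces? x
    ... | yes found = found
    ... | no none with trans (sym x∉Bᵀ) ([]=⇒lookup (∈Bᵀ x λ w f → none (w , f)))
    ...   | ()

  inBOrForced : ∀ w → ⟦ lookup B w ⟧ + ∑[ x < n ] ⟦ F x w ⟧ ≡ 1
  inBOrForced w = exactlyOne (lookup B w) (λ x → F x w) (λ x x' f f' → proj₂ wf x x' w f f') notForced forced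
    where
    notForced : lookup B w ≡ true → ∀ x → F x w ≡ false
    notForced w∈B x = ¬-not (λ f → proj₁ wf x w f (lookup⇒[]= w B w∈B))
    forced : lookup B w ≡ false → ∃ λ x → F x w ≡ true
    forced w∉B with blue⇒forced D B F t w (allBlue w)
    ... | inj₂ found = found
    ... | inj₁ w∈B with trans (sym w∉B) ([]=⇒lookup w∈B)
    ...   | ()

  ∣Bᵀ∣≡∣B∣ : ∣ Bᵀ ∣ ≡ ∣ B ∣
  ∣Bᵀ∣≡∣B∣ = +-cancelʳ-≡ #forces ∣ Bᵀ ∣ ∣ B ∣ (trans countByForcer (sym countByTarget))
    where
    open ≡-Reasoning
    #forces : ℕ
    #forces = ∑[ x < n ] ∑[ w < n ] ⟦ F x w ⟧
    countByForcer : ∣ Bᵀ ∣ + #forces ≡ n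
    countByForcer = begin
      ∣ Bᵀ ∣ + #forces                                       ≡⟨ cong (_+ #forces) (∣p∣≡∑ Bᵀ) ⟩
      ∑[ x < n ] ⟦ lookup Bᵀ x ⟧ + #forces                    ≡⟨ sym (∑-distrib-+ (λ x → ⟦ lookup Bᵀ x ⟧) _) ⟩
      ∑[ x < n ] (⟦ lookup Bᵀ x ⟧ + ∑[ w < n ] ⟦ F x w ⟧)     ≡⟨ sum-cong-≗ endsOrForces ⟩
      ∑[ x < n ] 1                                           ≡⟨ ∑-ones n ⟩
      n                                                      ∎
    countByTarget : ∣ B ∣ + #forces ≡ n
    countByTarget = begin
      ∣ B ∣ + #forces                                        ≡⟨ cong₂ _+_ (∣p∣≡∑ B) (∑-comm (λ x w → ⟦ F x w ⟧)) ⟩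
      ∑[ w < n ] ⟦ lookup B w ⟧ + ∑[ w < n ] ∑[ x < n ] ⟦ F x w ⟧ ≡⟨ sym (∑-distrib-+ (λ w → ⟦ lookup B w ⟧) _) ⟩
      ∑[ w < n ] (⟦ lookup B w ⟧ + ∑[ x < n ] ⟦ F x w ⟧)      ≡⟨ sum-cong-≗ inBOrForced ⟩
      ∑[ w < n ] 1                                           ≡⟨ ∑-ones n ⟩
      n                                                      ∎

reverse-achievable : ∀ {n} (D : Digraph n) k → Achievable D k → Achievable (D ᵀ) k
reverse-achievable D k (B , F , t , wf , allBlue , le) =
  Bᵀ , Fᵀ , t , wellFormedᵀ , allBlueᵀ , subst (λ c → c + t ≤ k) (sym ∣Bᵀ∣≡∣B∣) le
  where open Reverse D wf allBlue

th-ᵀ : ∀ {n} (D : Digraph n) → th (D ᵀ) ≡ th D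
th-ᵀ D = ≤-antisym (th-≤ D (D ᵀ) (reverse-achievable D)) (th-≤ (D ᵀ) D (reverse-achievable (D ᵀ)))

module Orientations {n : ℕ} (G : SimpleGraph n) where

  noArc : (O : Orientation G) → ∀ u v → adj G u v ≡ false → dir O u v ≡ false
  noArc O u v nonadjacent = ¬-not (λ d → true≢false (trans (sym (dir⊆adj O u v d)) nonadjacent))
    where
    true≢false : true ≢ false
    true≢false ()

  oneArc : (O : Orientation G) → ∀ u v → adj G u v ≡ true → dir O v u ≡ not (dir O u v)
  oneArc O u v adjacent with dir O u v in d | covers O u v adjacent
  ... | true | _ = oneWay O u v d
  ... | false | inj₂ d' = d'

  reverseO : Orientation G → Orientation G
  reverseO O = record
    { dir = dir O ᵀ
    ; dir⊆adj = λ u v d → trans (SimpleGraph.sym G u v) (dir⊆adj O v u d)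
    ; covers = λ u v adjacent → swap (covers O u v adjacent)
    ; oneWay = λ u v d → oneWay O v u d
    }

  AgreeOff : Orientation G → Orientation G → Fin n → Fin n → Set
  AgreeOff O O' u v = ∀ x y → ¬ (x ≡ u × y ≡ v) → ¬ (x ≡ v × y ≡ u) → dir O' x y ≡ dir O x y

  flipEdge : (O O' : Orientation G) (u v : Fin n) → dir O u v ≡ true → AgreeOff O O' u v →
             th (dir O') ≤ suc (th (dir O))
  flipEdge O O' u v uv agree = th-reverseArc (dir O) (dir O') u v (newArc , lostArc)
    where
    newArc : ∀ x y → dir O' x y ≡ true → dir O x y ≡ true ⊎ (x ≡ v × y ≡ u)
    newArc x y d' with x ≟F u ×-dec y ≟F v | x ≟F v ×-dec y ≟F u
    ... | yes (refl , refl) | _ = inj₁ uv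
    ... | no _ | yes (refl , refl) = inj₂ (refl , refl)
    ... | no ¬uv | no ¬vu = inj₁ (trans (sym (agree x y ¬uv ¬vu)) d')
    lostArc : ∀ x y → dir O x y ≡ true → dir O' x y ≡ true ⊎ (x ≡ u × y ≡ v)
    lostArc x y d with x ≟F u ×-dec y ≟F v | x ≟F v ×-dec y ≟F u
    ... | yes (refl , refl) | _ = inj₂ (refl , refl)
    ... | no ¬uv | no ¬vu = inj₁ (trans (agree x y ¬uv ¬vu) d)
    ... | no _ | yes (refl , refl) with trans (sym d) (oneWay O u v uv)
    ...   | ()

-- Hybrid orientations.  A list Q of vertex pairs switches the edges {x, y} with
-- x < y and (x , y) ∈ Q from the orientation O₁ to the orientation O₂.
_⋖_ : ∀ {n} → Fin n → Fin n → Bool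
x ⋖ y = toℕ x <ᵇ toℕ y

Switched : ∀ {n} → List (Fin n × Fin n) → Fin n → Fin n → Set
Switched Q x y = (x ⋖ y ≡ true × (x , y) ∈ₗ Q) ⊎ (y ⋖ x ≡ true × (y , x) ∈ₗ Q)

switched? : ∀ {n} Q (x y : Fin n) → Dec (Switched Q x y)
switched? Q x y = ((x ⋖ y ≟B true) ×-dec ((x , y) ∈?ₗ Q)) ⊎-dec ((y ⋖ x ≟B true) ×-dec ((y , x) ∈?ₗ Q))
  where open import Data.List.Membership.DecPropositional (≡-dec _≟F_ _≟F_) using () renaming (_∈?_ to _∈?ₗ_)

switched-sym : ∀ {n} Q (x y : Fin n) → does (switched? Q x y) ≡ does (switched? Q y x)
switched-sym Q x y = does-⇔ (mk⇔ swap swap) (switched? Q x y) (switched? Q y x)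

switched-skip : ∀ {n} (u v : Fin n) Q x y → ¬ (x ≡ u × y ≡ v) → ¬ (x ≡ v × y ≡ u) →
                does (switched? ((u , v) ∷ Q) x y) ≡ does (switched? Q x y)
switched-skip u v Q x y ¬uv ¬vu = does-⇔ (mk⇔ drop (Data.Sum.map (map₂ there) (map₂ there))) (switched? ((u , v) ∷ Q) x y) (switched? Q x y)
  where
  drop : Switched ((u , v) ∷ Q) x y → Switched Q x y
  drop (inj₁ (lt , here refl)) = ⊥-elim (¬uv (refl , refl))
  drop (inj₁ (lt , there m)) = inj₁ (lt , m)
  drop (inj₂ (lt , here refl)) = ⊥-elim (¬vu (refl , refl))
  drop (inj₂ (lt , there m)) = inj₂ (lt , m)

switched-unordered : ∀ {n} (u v : Fin n) Q x y → u ⋖ v ≡ false →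
                     does (switched? ((u , v) ∷ Q) x y) ≡ does (switched? Q x y)
switched-unordered u v Q x y u≮v = does-⇔ (mk⇔ drop (Data.Sum.map (map₂ there) (map₂ there))) (switched? ((u , v) ∷ Q) x y) (switched? Q x y)
  where
  drop : Switched ((u , v) ∷ Q) x y → Switched Q x y
  drop (inj₁ (lt , here refl)) with trans (sym lt) u≮v
  ... | ()
  drop (inj₁ (lt , there m)) = inj₁ (lt , m)
  drop (inj₂ (lt , here refl)) with trans (sym lt) u≮v
  ... | ()
  drop (inj₂ (lt , there m)) = inj₂ (lt , m)

allPairs : ∀ n → List (Fin n × Fin n)
allPairs n = cartesianProduct (allFin n) (allFin n)

switched-all : ∀ {n} (x y : Fin n) → x ≢ y → Switched (allPairs n) x y
switched-all x y x≢y with <-cmp (toℕ x) (toℕ y)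
... | tri< x<y _ _ = inj₁ (Equivalence.to T-≡ (<⇒<ᵇ x<y) , ∈-cartesianProduct⁺ (∈-allFin x) (∈-allFin y))
... | tri≈ _ x≡y _ = ⊥-elim (x≢y (toℕ-injective x≡y))
... | tri> _ _ y<x = inj₂ (Equivalence.to T-≡ (<⇒<ᵇ y<x) , ∈-cartesianProduct⁺ (∈-allFin y) (∈-allFin x))

module Hybrid {n : ℕ} (G : SimpleGraph n) (O₁ O₂ : Orientation G) where
  open Orientations G

  hybridDir : List (Fin n × Fin n) → Digraph n
  hybridDir Q x y = if does (switched? Q x y) then dir O₂ x y else dir O₁ x y

  hybrid : List (Fin n × Fin n) → Orientation G
  hybrid Q = record { dir = hybridDir Q ; dir⊆adj = arcsAreEdges ; covers = covering ; oneWay = oneWay' }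
    where
    arcsAreEdges : ∀ u v → hybridDir Q u v ≡ true → adj G u v ≡ true
    arcsAreEdges u v d with does (switched? Q u v)
    ... | true = dir⊆adj O₂ u v d
    ... | false = dir⊆adj O₁ u v d
    covering : ∀ u v → adj G u v ≡ true → hybridDir Q u v ≡ true ⊎ hybridDir Q v u ≡ true
    covering u v adjacent with does (switched? Q u v) | does (switched? Q v u) | switched-sym Q u v
    ... | true | .true | refl = covers O₂ u v adjacent
    ... | false | .false | refl = covers O₁ u v adjacent
    oneWay' : ∀ u v → hybridDir Q u v ≡ true → hybridDir Q v u ≡ false
    oneWay' u v d with does (switched? Q u v) | does (switched? Q v u) | switched-sym Q u v
    ... | true | .true | refl = oneWay O₂ u v d
    ... | false | .false | refl = oneWay O₁ u v d

  φ : List (Fin n × Fin n) → ℕ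
  φ Q = th (hybridDir Q)

  δ : Fin n × Fin n → ℕ
  δ (u , v) = ⟦ adj G u v ∧ (u ⋖ v ∧ (dir O₁ u v xor dir O₂ u v)) ⟧

  δ≤1 : ∀ q → δ q ≤ 1
  δ≤1 (u , v) with adj G u v ∧ (u ⋖ v ∧ (dir O₁ u v xor dir O₂ u v))
  ... | true = ≤-refl
  ... | false = z≤n

  unswitched : ∀ Q x y → dir O₁ x y ≡ dir O₂ x y → hybridDir Q x y ≡ dir O₁ x y
  unswitched Q x y same with does (switched? Q x y)
  ... | true = sym same
  ... | false = refl

  switch-invisible : ∀ u v Q → dir O₁ u v ≡ dir O₂ u v → dir O₁ v u ≡ dir O₂ v u →
                     hybridDir ((u , v) ∷ Q) ≐ hybridDir Q
  switch-invisible u v Q sameUV sameVU x y with x ≟F u ×-dec y ≟F v | x ≟F v ×-dec y ≟F u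
  ... | yes (refl , refl) | _ = trans (unswitched ((u , v) ∷ Q) x y sameUV) (sym (unswitched Q x y sameUV))
  ... | no _ | yes (refl , refl) = trans (unswitched ((u , v) ∷ Q) x y sameVU) (sym (unswitched Q x y sameVU))
  ... | no ¬uv | no ¬vu = cong (λ b → if b then dir O₂ x y else dir O₁ x y) (switched-skip u v Q x y ¬uv ¬vu)

  switch-step : ∀ q Q → φ (q ∷ Q) ≤ δ q + φ Q
  switch-step (u , v) Q = byCases (adj G u v) (u ⋖ v) (dir O₁ u v xor dir O₂ u v) refl refl refl
    where
    agreeOff : AgreeOff (hybrid Q) (hybrid ((u , v) ∷ Q)) u v
    agreeOff x y ¬uv ¬vu = cong (λ b → if b then dir O₂ x y else dir O₁ x y) (switched-skip u v Q x y ¬uv ¬vu)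
    invisible : hybridDir ((u , v) ∷ Q) ≐ hybridDir Q → φ ((u , v) ∷ Q) ≤ 0 + φ Q
    invisible same = ≤-reflexive (th-cong _ _ same)
    byCases : ∀ a l d → adj G u v ≡ a → u ⋖ v ≡ l → (dir O₁ u v xor dir O₂ u v) ≡ d →
              φ ((u , v) ∷ Q) ≤ ⟦ a ∧ (l ∧ d) ⟧ + φ Q
    byCases false _ _ nonadjacent _ _ = invisible (switch-invisible u v Q
      (trans (noArc O₁ u v nonadjacent) (sym (noArc O₂ u v nonadjacent)))
      (trans (noArc O₁ v u nonadjacentᵀ) (sym (noArc O₂ v u nonadjacentᵀ))))
      where
      nonadjacentᵀ : adj G v u ≡ false
      nonadjacentᵀ = trans (SimpleGraph.sym G v u) nonadjacent
    byCases true false _ _ u≮v _ = invisible λ x y →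
      cong (λ b → if b then dir O₂ x y else dir O₁ x y) (switched-unordered u v Q x y u≮v)
    byCases true true false adjacent _ agree = invisible (switch-invisible u v Q sameUV
      (trans (oneArc O₁ u v adjacent) (trans (cong not sameUV) (sym (oneArc O₂ u v adjacent)))))
      where
      xor-false : ∀ a b → (a xor b) ≡ false → a ≡ b
      xor-false true true _ = refl
      xor-false false false _ = refl
      sameUV : dir O₁ u v ≡ dir O₂ u v
      sameUV = xor-false _ _ agree
    byCases true true true adjacent _ _ with covers (hybrid Q) u v adjacent
    ... | inj₁ uv = flipEdge (hybrid Q) (hybrid ((u , v) ∷ Q)) u v uv agreeOff
    ... | inj₂ vu = flipEdge (hybrid Q) (hybrid ((u , v) ∷ Q)) v u vu (λ x y ¬vu ¬uv → agreeOff x y ¬uv ¬vu)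


  cost : List (Fin n × Fin n) → ℕ
  cost Q = sum (map δ Q)

  walk-cost : ∀ Q → φ Q ≤ cost Q + φ []
  walk-cost [] = ≤-refl
  walk-cost (q ∷ Q) = ≤-trans (switch-step q Q)
    (≤-trans (+-monoʳ-≤ (δ q) (walk-cost Q)) (≤-reflexive (sym (+-assoc (δ q) (cost Q) (φ [])))))

  -- discrete intermediate value theorem: th moves up by at most one per switch
  walk-intermediate : ∀ Q k → φ [] ≤ k → k ≤ φ Q → ∃ λ Q' → φ Q' ≡ k
  walk-intermediate [] k start≤k k≤end = [] , ≤-antisym start≤k k≤end
  walk-intermediate (q ∷ Q) k start≤k k≤end with k ≤? φ Q
  ... | yes k≤φQ = walk-intermediate Q k start≤k k≤φQ
  ... | no k≰φQ = q ∷ Q , ≤-antisym φ≤k k≤end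
    where
    φ≤k : φ (q ∷ Q) ≤ k
    φ≤k = ≤-trans (switch-step q Q) (≤-trans (+-monoˡ-≤ (φ Q) (δ≤1 q)) (≰⇒> k≰φQ))

  hybrid-start : hybridDir [] ≐ dir O₁
  hybrid-start x y = cong (λ b → if b then dir O₂ x y else dir O₁ x y)
                          (dec-false (switched? [] x y) λ { (inj₁ (_ , ())) ; (inj₂ (_ , ())) })

  hybrid-end : hybridDir (allPairs n) ≐ dir O₂
  hybrid-end x y with x ≟F y
  ... | yes refl = trans (unswitched (allPairs n) x x loops) loops
    where
    loops : dir O₁ x x ≡ dir O₂ x x
    loops = trans (noArc O₁ x x (irrefl G x)) (sym (noArc O₂ x x (irrefl G x)))
  ... | no x≢y = cong (λ b → if b then dir O₂ x y else dir O₁ x y) (dec-true (switched? _ x y) (switched-all x y x≢y))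

  th-start : φ [] ≡ th (dir O₁)
  th-start = th-cong _ _ hybrid-start

  th-end : φ (allPairs n) ≡ th (dir O₂)
  th-end = th-cong _ _ hybrid-end

  th-spread : th (dir O₂) ∸ th (dir O₁) ≤ cost (allPairs n)
  th-spread = m≤n+o⇒m∸n≤o (th (dir O₂)) (th (dir O₁))
    (subst₂ (λ a b → a ≤ b + cost (allPairs n)) th-end th-start
      (≤-trans (walk-cost (allPairs n)) (≤-reflexive (+-comm (cost (allPairs n)) (φ [])))))

  th-intermediate : ∀ k → th (dir O₁) ≤ k → k ≤ th (dir O₂) → ∃ λ (O : Orientation G) → th (dir O) ≡ k
  th-intermediate k start≤k k≤end with walk-intermediate (allPairs n) k (subst (_≤ k) (sym th-start) start≤k)
                                                                        (subst (k ≤_) (sym th-end) k≤end)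
  ... | Q , φQ≡k = hybrid Q , φQ≡k

sum-map-+ : ∀ {A : Set} (f g : A → ℕ) (L : List A) →
            sum (map (λ a → f a + g a) L) ≡ sum (map f L) + sum (map g L)
sum-map-+ f g [] = refl
sum-map-+ f g (a ∷ L) = trans (cong (f a + g a +_) (sum-map-+ f g L)) (+-interchange (f a) (g a) _ _)

sum-cartesianProduct : ∀ {A B : Set} (f : A × B → ℕ) (xs : List A) (ys : List B) →
  sum (map f (cartesianProduct xs ys)) ≡ sum (map (λ x → sum (map (λ y → f (x , y)) ys)) xs)
sum-cartesianProduct f [] ys = refl
sum-cartesianProduct f (x ∷ xs) ys = begin
  sum (map f (map (x ,_) ys ++ cartesianProduct xs ys))               ≡⟨ cong sum (map-++ f (map (x ,_) ys) _) ⟩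
  sum (map f (map (x ,_) ys) ++ map f (cartesianProduct xs ys))       ≡⟨ sum-++ (map f (map (x ,_) ys)) _ ⟩
  sum (map f (map (x ,_) ys)) + sum (map f (cartesianProduct xs ys))  ≡⟨ cong₂ _+_ (cong sum (sym (map-∘ ys))) (sum-cartesianProduct f xs ys) ⟩
  sum (map (λ y → f (x , y)) ys) + sum (map (λ x → sum (map (λ y → f (x , y)) ys)) xs) ∎
  where open ≡-Reasoning

disagreeOnce : ∀ (a l o₁ o₂ o₂ᵀ : Bool) → (a ≡ true → o₂ᵀ ≡ not o₂) →
               ⟦ a ∧ (l ∧ (o₁ xor o₂)) ⟧ + ⟦ a ∧ (l ∧ (o₁ xor o₂ᵀ)) ⟧ ≡ ⟦ a ∧ l ⟧
disagreeOnce false l o₁ o₂ o₂ᵀ _ = refl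
disagreeOnce true false o₁ o₂ o₂ᵀ _ = refl
disagreeOnce true true o₁ o₂ o₂ᵀ reversed rewrite reversed refl with o₁ | o₂
... | true | true = refl
... | true | false = refl
... | false | true = refl
... | false | false = refl

disagreements : ∀ {n} (G : SimpleGraph n) (O₁ O₂ : Orientation G) →
  Hybrid.cost G O₁ O₂ (allPairs n) + Hybrid.cost G O₁ (Orientations.reverseO G O₂) (allPairs n) ≡ numEdges G
disagreements {n} G O₁ O₂ = begin
  W.cost (allPairs n) + Wᵀ.cost (allPairs n)      ≡⟨ sym (sum-map-+ W.δ Wᵀ.δ (allPairs n)) ⟩
  sum (map (λ q → W.δ q + Wᵀ.δ q) (allPairs n))   ≡⟨ cong sum (map-cong perEdge (allPairs n)) ⟩
  sum (map isEdge (allPairs n))                   ≡⟨ sum-cartesianProduct isEdge (allFin n) (allFin n) ⟩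
  numEdges G                                      ∎
  where
  open ≡-Reasoning
  module W = Hybrid G O₁ O₂
  module Wᵀ = Hybrid G O₁ (Orientations.reverseO G O₂)
  isEdge : Fin n × Fin n → ℕ
  isEdge (u , v) = ⟦ adj G u v ∧ (u ⋖ v) ⟧
  perEdge : ∀ q → W.δ q + Wᵀ.δ q ≡ isEdge q
  perEdge (u , v) = disagreeOnce (adj G u v) (u ⋖ v) (dir O₁ u v) (dir O₂ u v) (dir O₂ v u) (Orientations.oneArc G O₂ u v)

≤half : ∀ a e → a + a ≤ e → a ≤ ⌊ e /2⌋
≤half a e a+a≤e = ≤-trans (≤-reflexive (n≡⌊n+n/2⌋ a)) (⌊n/2⌋-mono a+a≤e)

corollary3p3 : ∀ {n} (G : SimpleGraph n) (m M : ℕ) →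
    IsMinOTh G m → IsMaxOTh G M →
    (M ∸ m ≤ ⌊ numEdges G /2⌋) ×
    (∀ k → m ≤ k → k ≤ M → ∃ λ (o : Orientation G) → IsTh (dir o) k)
corollary3p3 {n} G m M ((O₁ , th-m) , _) ((O₂ , th-M) , _) = spread , intermediate
  where
  open Orientations G using (reverseO)
  th₁≡m : th (dir O₁) ≡ m
  th₁≡m = th-unique (dir O₁) m th-m
  th₂≡M : th (dir O₂) ≡ M
  th₂≡M = th-unique (dir O₂) M th-M
  th₂ᵀ≡M : th (dir (reverseO O₂)) ≡ M
  th₂ᵀ≡M = trans (th-ᵀ (dir O₂)) th₂≡M
  differ : Orientation G → ℕ
  differ O = Hybrid.cost G O₁ O (allPairs n)
  spreadVia : ∀ O → th (dir O) ≡ M → M ∸ m ≤ differ O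
  spreadVia O thO≡M = subst₂ (λ a b → a ∸ b ≤ differ O) thO≡M th₁≡m (Hybrid.th-spread G O₁ O)
  spread : M ∸ m ≤ ⌊ numEdges G /2⌋
  spread = ≤half (M ∸ m) (numEdges G) (≤-trans (+-mono-≤ (spreadVia O₂ th₂≡M) (spreadVia (reverseO O₂) th₂ᵀ≡M))
                                                (≤-reflexive (disagreements G O₁ O₂)))
  intermediate : ∀ k → m ≤ k → k ≤ M → ∃ λ (o : Orientation G) → IsTh (dir o) k
  intermediate k m≤k k≤M with Hybrid.th-intermediate G O₁ O₂ k (subst (_≤ k) (sym th₁≡m) m≤k)
                                                               (subst (k ≤_) (sym th₂≡M) k≤M)
  ... | O , thO≡k = O , subst (IsTh (dir O)) thO≡k (th-spec (dir O))
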